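{- Let $q$ be a prime power, $n,k$ integers with $1<k<n-1$, $V=\mathbb{F}_q^n$, and let $X,Y\in\mathcal{C}(n,k)_q$. If $X\cup Y$ contains a vector of weight $n$, then $d_c(X,Y)=d(X,Y)$; otherwise $d(X,Y)\le d_c(X,Y)\le d(X,Y)+1$.
   Context: $\mathbb{F}_q$ is the finite field with $q$ elements. For $i=1,\dots,n$, $C_i=\{(x_1,\dots,x_n)\in V: x_i=0\}$. A non-degenerate linear $[n,k]_q$ code is a $k$-dimensional subspace of $V$ not contained in any $C_i$; $\mathcal{C}(n,k)_q$ is the set of all such codes. The weight of a vector $x\in V$ is the number of its non-zero coordinates. The Grassmann graph $\Gamma_k(V)$ has as vertices the $k$-dimensional subspaces of $V$, two adjacent iff their intersection is $(k-1)$-dimensional; its graph distance is $d(X,Y)=k-\dim(X\cap Y)$. $\Gamma(n,k)_q$ is the induced subgraph of $\Gamma_k(V)$ on $\mathcal{C}(n,k)_q$ (it is connected), and $d_c(X,Y)$ denotes the graph distance between $X$ and $Y$ in $\Gamma(n,k)_q$. -}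

module Defs where

import Level
open import Level using (0ℓ; Lift)
open import Data.Nat using (ℕ; zero; suc; _≤_; _∸_; _^_)
open import Data.Nat.Primality using (Prime)
open import Data.Fin using (Fin)
open import Data.Product using (Σ; ∃; _×_; _,_)
open import Relation.Nullary using (¬_)
open import Relation.Binary.PropositionalEquality using (_≡_)
open import Function.Bundles using (_↔_; _⇔_)
open import Algebra.Core using (Op₁; Op₂)
open import Algebra.Structures using (IsCommutativeRing)

IsPrimePower : ℕ → Set
IsPrimePower q = Σ ℕ λ p → Σ ℕ λ e → Prime p × (1 ≤ e) × (q ≡ p ^ e)

record FiniteField (q : ℕ) : Set₁ where
  infixl 6 _+_
  infixl 7 _*_
  field
    Carrier : Set
    _+_ _*_ : Op₂ Carrier
    -_ : Op₁ Carrier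
    0# 1# : Carrier
    isCommutativeRing : IsCommutativeRing _≡_ _+_ _*_ -_ 0# 1#
    0≢1 : ¬ (0# ≡ 1#)
    inverse : ∀ x → ¬ (x ≡ 0#) → ∃ λ y → x * y ≡ 1#
    cardinality : Fin q ↔ Carrier

module LinearAlgebra {q : ℕ} (F : FiniteField q) (n : ℕ) where
  open FiniteField F

  V : Set
  V = Fin n → Carrier

  _≋_ : V → V → Set
  x ≋ y = ∀ i → x i ≡ y i

  0V : V
  0V _ = 0#

  _+V_ : V → V → V
  (x +V y) i = x i + y i

  _·_ : Carrier → V → V
  (a · x) i = a * x i

  lincomb : ∀ {m} → (Fin m → Carrier) → (Fin m → V) → V
  lincomb {zero} c v = 0V
  lincomb {suc m} c v = (c Fin.zero · v Fin.zero) +V lincomb (λ i → c (Fin.suc i)) (λ i → v (Fin.suc i))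
    where import Data.Fin as Fin

  Span : ∀ {m} → (Fin m → V) → V → Set
  Span v x = ∃ λ c → x ≋ lincomb c v

  LinearlyIndependent : ∀ {m} → (Fin m → V) → Set
  LinearlyIndependent v = ∀ c → lincomb c v ≋ 0V → ∀ i → c i ≡ 0#

  HasDim : (V → Set) → ℕ → Set
  HasDim P m = Σ (Fin m → V) λ b → LinearlyIndependent b × (∀ x → P x ⇔ Span b x)

  FullWeight : V → Set
  FullWeight x = ∀ i → ¬ (x i ≡ 0#)

  record Code (k : ℕ) : Set₁ where
    field
      pts : V → Set
      dim : HasDim pts k
      nondeg : ∀ i → ¬ (∀ x → pts x → x i ≡ 0#)
  open Code public

  _∩_ : (V → Set) → (V → Set) → V → Set
  (P ∩ Q) x = P x × Q x

  module _ {k : ℕ} where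
    SameCode : Code k → Code k → Set
    SameCode X Y = ∀ x → pts X x ⇔ pts Y x

    Adjacent : Code k → Code k → Set
    Adjacent X Y = HasDim (pts X ∩ pts Y) (k ∸ 1)

    Path : Code k → Code k → ℕ → Set₁
    Path X Y zero = Lift (Level.suc 0ℓ) (SameCode X Y)
    Path X Y (suc l) = Σ (Code k) λ Z → Lift (Level.suc 0ℓ) (Adjacent X Z) × Path Z Y l

    DistC : Code k → Code k → ℕ → Set₁
    DistC X Y l = Path X Y l × (∀ l′ → Path X Y l′ → l ≤ l′)

-- Let d = k − dim (X ∩ Y). Moving to an adjacent code costs an independent family of vectors at most one
-- member (exchange lemma), so every walk from X to Y has length at least d. Conversely, if X ∪ Y contains a
-- full-weight vector f, one steps from X to ⟨y, H⟩ with H ⊇ X ∩ Y a hyperplane of X and y ∈ Y ∖ X, keeping f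
-- inside: the new code is non-degenerate because it contains f, and it meets Y in one more dimension, so d
-- steps reach Y. Without such a vector, one first steps to a code through the all-ones vector, which gives a
-- walk of length d + 1; as everything is finite, whether a walk of length d exists is decidable.

module Submission where

import Level
open import Data.Nat as ℕ using (ℕ; zero; suc; _<_; _≤_; _∸_; z≤n; s≤s)
import Data.Nat.Properties as ℕₚ
open import Data.Fin using (Fin; zero; suc; punchIn)
import Data.Fin.Properties as Fin
open import Data.Vec.Functional using (_∷_; head; tail; insertAt)
open import Data.Vec.Functional.Properties using (insertAt-lookup; insertAt-punchIn)
open import Data.Vec.Functional.Relation.Binary.Pointwise using (Pointwise)
open import Data.Product using (Σ; ∃; _×_; _,_; proj₁; proj₂)
open import Data.Sum using (_⊎_; inj₁; inj₂)
open import Data.Empty using (⊥-elim)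
open import Relation.Nullary using (¬_; Dec; yes; no)
open import Relation.Nullary.Decidable using (¬?; _×-dec_; _→-dec_; decidable-stable)
import Relation.Nullary.Decidable as Dec
open import Relation.Binary.PropositionalEquality
open import Function using (_∘_; _⇔_; mk⇔; Equivalence; Inverse)
open import Function.Construct.Identity using (⇔-id)
open import Function.Construct.Symmetry using (⇔-sym)
open import Function.Construct.Composition using (_⇔-∘_)
open import Algebra.Bundles using (CommutativeRing)

open import Defs

Searchable : ∀ ℓ (A : Set) → (A → A → Set) → Set (Level.suc ℓ)
Searchable ℓ A _≈_ =
  (P : A → Set ℓ) → (∀ a → Dec (P a)) → (∀ {a b} → a ≈ b → P a → P b) → Dec (∃ P)

searchable-Vector : ∀ {ℓ A _≈_} → (∀ a → a ≈ a) → Searchable ℓ A _≈_ →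
                    ∀ m → Searchable ℓ (Fin m → A) (Pointwise _≈_)
searchable-Vector refl′ S zero P P? resp with P? (λ ())
... | yes p = yes (_ , p)
... | no ¬p = no λ (f , pf) → ¬p (resp (λ ()) pf)
searchable-Vector refl′ S (suc m) P P? resp
  with S (λ a → ∃ λ f → P (a ∷ f))
         (λ a → searchable-Vector refl′ S m (λ f → P (a ∷ f)) (λ f → P? _)
                  (λ {f} eq → resp λ { zero → refl′ a ; (suc i) → eq i }))
         (λ {a} eq (f , p) → f , resp (λ { zero → eq ; (suc i) → refl′ (f i) }) p)
... | yes (a , f , p) = yes (a ∷ f , p)
... | no ¬p = no λ (f , pf) →
  ¬p (head f , tail f , resp (λ { zero → refl′ (head f) ; (suc i) → refl′ (f (suc i)) }) pf)

searchable⇒∀? : ∀ {A _≈_} → (∀ {a b} → a ≈ b → b ≈ a) → Searchable Level.zero A _≈_ →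
                (P : A → Set) → (∀ a → Dec (P a)) → (∀ {a b} → a ≈ b → P a → P b) → Dec (∀ a → P a)
searchable⇒∀? sym′ S P P? resp with S (λ a → ¬ P a) (λ a → ¬? (P? a)) (λ eq ¬pa pb → ¬pa (resp (sym′ eq) pb))
... | yes (a , ¬pa) = no λ all → ¬pa (all a)
... | no ∄¬P = yes λ a → decidable-stable (P? a) (λ ¬pa → ∄¬P (a , ¬pa))

_⇔?_ : ∀ {A B : Set} → Dec A → Dec B → Dec (A ⇔ B)
a? ⇔? b? = Dec.map (mk⇔ (λ (f , g) → mk⇔ f g) (λ e → Equivalence.to e , Equivalence.from e))
                   ((a? →-dec b?) ×-dec (b? →-dec a?))

module CodeGraph {q : ℕ} (F : FiniteField q) (n : ℕ) where
  open FiniteField F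
  open LinearAlgebra F n
  private
    R : CommutativeRing _ _
    R = record { isCommutativeRing = isCommutativeRing }
  open CommutativeRing R
    using (+-identityˡ; +-identityʳ; zeroˡ; zeroʳ; *-identityˡ; *-identityʳ; -‿inverseʳ; +-comm; +-assoc; ring)
  open import Algebra.Properties.Ring ring using (-‿distribˡ-*; -‿distribʳ-*; -‿involutive; +-inverseʳ-unique; -1*x≈-x)
  open import Algebra.Solver.Ring.NaturalCoefficients.Default (CommutativeRing.commutativeSemiring R)

  -- Finiteness and decidability

  _≟_ : (x y : Carrier) → Dec (x ≡ y)
  x ≟ y = Dec.map′ from-injective (cong from) (from x Fin.≟ from y)
    where
      open Inverse cardinality
      from-injective : from x ≡ from y → x ≡ y
      from-injective e = trans (sym (strictlyInverseˡ x)) (trans (cong to e) (strictlyInverseˡ y))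

  searchable-Carrier : ∀ {ℓ} → Searchable ℓ Carrier _≡_
  searchable-Carrier P P? resp with Fin.any? (λ i → P? (to i))
    where open Inverse cardinality
  ... | yes (i , p) = yes (_ , p)
  ... | no ∄P = no λ (c , pc) → ∄P (from c , resp (sym (strictlyInverseˡ c)) pc)
    where open Inverse cardinality

  searchable-coefficients : ∀ {ℓ} m → Searchable ℓ (Fin m → Carrier) (Pointwise _≡_)
  searchable-coefficients = searchable-Vector (λ _ → refl) searchable-Carrier

  searchable-V : ∀ {ℓ} → Searchable ℓ V _≋_
  searchable-V = searchable-coefficients n

  searchable-families : ∀ {ℓ} m → Searchable ℓ (Fin m → V) (Pointwise _≋_)
  searchable-families = searchable-Vector (λ _ _ → refl) searchable-V

  ≋-refl : ∀ {x} → x ≋ x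
  ≋-refl _ = refl

  ≋-sym : ∀ {x y} → x ≋ y → y ≋ x
  ≋-sym e i = sym (e i)

  ≋-trans : ∀ {x y z} → x ≋ y → y ≋ z → x ≋ z
  ≋-trans e f i = trans (e i) (f i)

  ∀V? : (P : V → Set) → (∀ x → Dec (P x)) → (∀ {x y} → x ≋ y → P x → P y) → Dec (∀ x → P x)
  ∀V? = searchable⇒∀? ≋-sym searchable-V

  ∀coefficients? : ∀ m (P : (Fin m → Carrier) → Set) → (∀ c → Dec (P c)) →
                   (∀ {c d} → Pointwise _≡_ c d → P c → P d) → Dec (∀ c → P c)
  ∀coefficients? m = searchable⇒∀? (λ e i → sym (e i)) (searchable-coefficients m)

  _≋?_ : (x y : V) → Dec (x ≋ y)
  x ≋? y = Fin.all? (λ i → x i ≟ y i)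

  _⁻¹⟨_⟩ : (x : Carrier) → ¬ (x ≡ 0#) → Carrier
  x ⁻¹⟨ x≢0 ⟩ = proj₁ (inverse x x≢0)

  *-inverseʳ : ∀ x (x≢0 : ¬ (x ≡ 0#)) → x * x ⁻¹⟨ x≢0 ⟩ ≡ 1#
  *-inverseʳ x x≢0 = proj₂ (inverse x x≢0)

  solve-unit : ∀ c e z l → c * e ≡ 1# → c * z + l ≡ 0# → z ≡ (- e) * l
  solve-unit c e z l ce≡1 eq = begin
      z                    ≡⟨ sym (*-identityˡ z) ⟩
      1# * z               ≡⟨ cong (_* z) (sym ce≡1) ⟩
      (c * e) * z          ≡⟨ solve 3 (λ c e z → (c :* e :* z) := (e :* (c :* z))) refl c e z ⟩
      e * (c * z)          ≡⟨ sym (-‿involutive _) ⟩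
      - - (e * (c * z))    ≡⟨ cong -_ (-‿distribˡ-* e (c * z)) ⟩
      - ((- e) * (c * z))  ≡⟨ -‿distribʳ-* (- e) (c * z) ⟩
      (- e) * (- (c * z))  ≡⟨ cong ((- e) *_) (sym (+-inverseʳ-unique _ _ eq)) ⟩
      (- e) * l            ∎
    where open ≡-Reasoning

  pivot-cancels : ∀ a p e → p * e ≡ 1# → a + (- (a * e)) * p ≡ 0#
  pivot-cancels a p e pe≡1 = begin
      a + (- (a * e)) * p   ≡⟨ cong (a +_) (sym (-‿distribˡ-* (a * e) p)) ⟩
      a + - (a * e * p)     ≡⟨ cong (λ t → a + - t) (solve 3 (λ a e p → (a :* e :* p) := (a :* (p :* e))) refl a e p) ⟩
      a + - (a * (p * e))   ≡⟨ cong (λ t → a + - (a * t)) pe≡1 ⟩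
      a + - (a * 1#)        ≡⟨ cong (λ t → a + - t) (*-identityʳ a) ⟩
      a + - a               ≡⟨ -‿inverseʳ a ⟩
      0#                    ∎
    where open ≡-Reasoning

  lincomb-cong : ∀ {m} {c c′ : Fin m → Carrier} {v v′ : Fin m → V} →
                 Pointwise _≡_ c c′ → Pointwise _≋_ v v′ → lincomb c v ≋ lincomb c′ v′
  lincomb-cong {zero} ec ev p = refl
  lincomb-cong {suc m} ec ev p =
    cong₂ _+_ (cong₂ _*_ (ec zero) (ev zero p)) (lincomb-cong (ec ∘ suc) (ev ∘ suc) p)

  lincomb-0# : ∀ {m} (v : Fin m → V) → lincomb (λ _ → 0#) v ≋ 0V
  lincomb-0# {zero} v p = refl
  lincomb-0# {suc m} v p = trans (cong₂ _+_ (zeroˡ (v zero p)) (lincomb-0# (v ∘ suc) p)) (+-identityˡ 0#)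

  lincomb-+ : ∀ {m} (c d : Fin m → Carrier) (v : Fin m → V) →
              lincomb (λ i → c i + d i) v ≋ (lincomb c v +V lincomb d v)
  lincomb-+ {zero} c d v p = sym (+-identityˡ 0#)
  lincomb-+ {suc m} c d v p =
    trans (cong ((c zero + d zero) * v zero p +_) (lincomb-+ (c ∘ suc) (d ∘ suc) (v ∘ suc) p))
          (solve 5 (λ a b x l r → ((a :+ b) :* x :+ (l :+ r)) := ((a :* x :+ l) :+ (b :* x :+ r))) refl
             (c zero) (d zero) (v zero p) (lincomb (c ∘ suc) (v ∘ suc) p) (lincomb (d ∘ suc) (v ∘ suc) p))

  lincomb-· : ∀ {m} a (c : Fin m → Carrier) (v : Fin m → V) → lincomb (λ i → a * c i) v ≋ (a · lincomb c v)
  lincomb-· {zero} a c v p = sym (zeroʳ a)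
  lincomb-· {suc m} a c v p =
    trans (cong (a * c zero * v zero p +_) (lincomb-· a (c ∘ suc) (v ∘ suc) p))
          (solve 4 (λ a b x l → (a :* b :* x :+ a :* l) := (a :* (b :* x :+ l))) refl
             a (c zero) (v zero p) (lincomb (c ∘ suc) (v ∘ suc) p))

  lincomb-pick : ∀ {m} (c : Fin (suc m) → Carrier) (v : Fin (suc m) → V) i →
                 lincomb c v ≋ ((c i · v i) +V lincomb (c ∘ punchIn i) (v ∘ punchIn i))
  lincomb-pick c v zero p = refl
  lincomb-pick {suc m} c v (suc i) p =
    trans (cong (c zero * v zero p +_) (lincomb-pick (c ∘ suc) (v ∘ suc) i p))
          (solve 3 (λ a b r → (a :+ (b :+ r)) := (b :+ (a :+ r))) refl
             (c zero * v zero p) (c (suc i) * v (suc i) p) (lincomb (c ∘ suc ∘ punchIn i) (v ∘ suc ∘ punchIn i) p))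

  lincomb-insertAt : ∀ {m} (c : Fin m → Carrier) i a (v : Fin (suc m) → V) →
                     lincomb (insertAt c i a) v ≋ ((a · v i) +V lincomb c (v ∘ punchIn i))
  lincomb-insertAt c i a v p = trans (lincomb-pick (insertAt c i a) v i p)
    (cong₂ _+_ (cong (_* v i p) (insertAt-lookup c i a)) (lincomb-cong (insertAt-punchIn c i a) (λ _ → ≋-refl) p))

  dot : ∀ {m} → (Fin m → Carrier) → (Fin m → Carrier) → Carrier
  dot {zero} c s = 0#
  dot {suc m} c s = c zero * s zero + dot (c ∘ suc) (s ∘ suc)

  lincomb-shift : ∀ {m} (c s : Fin m → Carrier) (x : Fin m → V) z →
                  lincomb c (λ j → x j +V (s j · z)) ≋ (lincomb c x +V (dot c s · z))
  lincomb-shift {zero} c s x z p = sym (trans (cong (0# +_) (zeroˡ (z p))) (+-identityʳ 0#))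
  lincomb-shift {suc m} c s x z p =
    trans (cong (c zero * (x zero p + s zero * z p) +_) (lincomb-shift (c ∘ suc) (s ∘ suc) (x ∘ suc) z p))
      (solve 6 (λ c x s z l d → (c :* (x :+ s :* z) :+ (l :+ d :* z)) := ((c :* x :+ l) :+ (c :* s :+ d) :* z)) refl
         (c zero) (x zero p) (s zero) (z p) (lincomb (c ∘ suc) (x ∘ suc) p) (dot (c ∘ suc) (s ∘ suc)))

  module _ {m} {v : Fin m → V} where
    Span-cong : ∀ {x y} → x ≋ y → Span v x → Span v y
    Span-cong e (c , x≋) = c , ≋-trans (≋-sym e) x≋

    Span-0V : Span v 0V
    Span-0V = (λ _ → 0#) , ≋-sym (lincomb-0# v)

    Span-+ : ∀ {x y} → Span v x → Span v y → Span v (x +V y)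
    Span-+ (c , x≋) (d , y≋) = (λ i → c i + d i) , λ p → trans (cong₂ _+_ (x≋ p) (y≋ p)) (sym (lincomb-+ c d v p))

    Span-· : ∀ a {x} → Span v x → Span v (a · x)
    Span-· a (c , x≋) = (λ i → a * c i) , λ p → trans (cong (a *_) (x≋ p)) (sym (lincomb-· a c v p))

    Span? : ∀ x → Dec (Span v x)
    Span? x = searchable-coefficients m (λ c → x ≋ lincomb c v) (λ c → x ≋? lincomb c v)
                (λ e x≋ → ≋-trans x≋ (lincomb-cong e (λ _ → ≋-refl)))

  Span-generator : ∀ {m} (v : Fin m → V) i → Span v (v i)
  Span-generator {suc m} v i = insertAt (λ _ → 0#) i 1# ,
    λ p → sym (trans (lincomb-insertAt (λ _ → 0#) i 1# v p)
                (trans (cong₂ _+_ (*-identityˡ (v i p)) (lincomb-0# (v ∘ punchIn i) p)) (+-identityʳ _)))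

  Span-generators-cong : ∀ {m} {v v′ : Fin m → V} {x} → Pointwise _≋_ v v′ → Span v x → Span v′ x
  Span-generators-cong e (c , x≋) = c , ≋-trans x≋ (lincomb-cong (λ _ → refl) e)

  Span-∷⁺ : ∀ {m} {u : Fin m → V} {z x} → Span u x → Span (z ∷ u) x
  Span-∷⁺ {u = u} {z} (c , x≋) = 0# ∷ c ,
    λ p → trans (x≋ p) (sym (trans (cong (_+ lincomb c u p) (zeroˡ (z p))) (+-identityˡ _)))

  Span-head : ∀ {m} {u : Fin m → V} {z} → Span (z ∷ u) z
  Span-head {u = u} {z} = 1# ∷ (λ _ → 0#) ,
    λ p → sym (trans (cong₂ _+_ (*-identityˡ (z p)) (lincomb-0# u p)) (+-identityʳ _))

  Span-tail : ∀ {b} (c : Fin (suc b) → Carrier) (w : Fin (suc b) → V) {x} →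
              x ≋ lincomb c w → c zero ≡ 0# → Span (tail w) x
  Span-tail c w x≋ c₀≡0 = tail c ,
    λ p → let r = lincomb (tail c) (tail w) p in
      trans (x≋ p) (trans (cong (λ t → t * w zero p + r) c₀≡0) (trans (cong (_+ r) (zeroˡ (w zero p))) (+-identityˡ r)))

  Span-lincomb : ∀ {m b} {w : Fin b → V} {u : Fin m → V} → (∀ i → Span w (u i)) → ∀ c → Span w (lincomb c u)
  Span-lincomb {zero} u⊆w c = Span-0V
  Span-lincomb {suc m} u⊆w c = Span-+ (Span-· (c zero) (u⊆w zero)) (Span-lincomb (u⊆w ∘ suc) (c ∘ suc))

  Span-trans : ∀ {m b} {w : Fin b → V} {u : Fin m → V} {x} → (∀ i → Span w (u i)) → Span u x → Span w x
  Span-trans u⊆w (c , x≋) = Span-cong (≋-sym x≋) (Span-lincomb u⊆w c)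

  LinearlyIndependent? : ∀ {m} (v : Fin m → V) → Dec (LinearlyIndependent v)
  LinearlyIndependent? {m} v = ∀coefficients? m (λ c → lincomb c v ≋ 0V → ∀ i → c i ≡ 0#)
    (λ c → (lincomb c v ≋? 0V) →-dec Fin.all? (λ i → c i ≟ 0#))
    (λ e indep lc≋0 i → trans (sym (e i)) (indep (≋-trans (lincomb-cong e (λ _ → ≋-refl)) lc≋0) i))

  LinearlyIndependent-cong : ∀ {m} {v v′ : Fin m → V} → Pointwise _≋_ v v′ →
                             LinearlyIndependent v → LinearlyIndependent v′
  LinearlyIndependent-cong e indep c lc≋0 = indep c (≋-trans (lincomb-cong (λ _ → refl) e) lc≋0)

  LinearlyIndependent-tail : ∀ {m} {v : Fin (suc m) → V} → LinearlyIndependent v → LinearlyIndependent (tail v)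
  LinearlyIndependent-tail {v = v} indep c lc≋0 i = indep (0# ∷ c)
    (λ p → let r = lincomb c (tail v) p in trans (cong (_+ r) (zeroˡ (v zero p))) (trans (+-identityˡ r) (lc≋0 p)))
    (suc i)

  LinearlyIndependent-∷ : ∀ {m} {u : Fin m → V} {z} → LinearlyIndependent u → ¬ Span u z →
                          LinearlyIndependent (z ∷ u)
  LinearlyIndependent-∷ {u = u} {z} indep z∉u c lc≋0 with c zero ≟ 0#
  ... | yes c₀≡0 = λ { zero → c₀≡0 ; (suc i) → indep (tail c) tail≋0 i }
    where
      tail≋0 : lincomb (tail c) u ≋ 0V
      tail≋0 p = let r = lincomb (tail c) u p in
        trans (sym (trans (cong (_+ r) (trans (cong (_* z p) c₀≡0) (zeroˡ (z p)))) (+-identityˡ r))) (lc≋0 p)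
  ... | no c₀≢0 = ⊥-elim (z∉u ((λ j → (- e) * c (suc j)) ,
          λ p → trans (solve-unit (c zero) e (z p) (lincomb (tail c) u p) (*-inverseʳ (c zero) c₀≢0) (lc≋0 p))
                      (sym (lincomb-· (- e) (tail c) u p))))
    where e = c zero ⁻¹⟨ c₀≢0 ⟩

  -- The exchange lemma

  eliminate : ∀ {a} (v : Fin (suc a) → V) (i₀ : Fin (suc a)) (s : Fin a → Carrier) → Fin a → V
  eliminate v i₀ s j = v (punchIn i₀ j) +V (s j · v i₀)

  eliminate-independent : ∀ {a} {v : Fin (suc a) → V} i₀ s →
                          LinearlyIndependent v → LinearlyIndependent (eliminate v i₀ s)
  eliminate-independent {v = v} i₀ s indep c lc≋0 j =
      trans (sym (insertAt-punchIn c i₀ (dot c s) j)) (indep (insertAt c i₀ (dot c s)) lc≋0′ (punchIn i₀ j))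
    where
      lc≋0′ : lincomb (insertAt c i₀ (dot c s)) v ≋ 0V
      lc≋0′ p = trans (lincomb-insertAt c i₀ (dot c s) v p)
        (trans (+-comm _ _) (trans (sym (lincomb-shift c s (v ∘ punchIn i₀) (v i₀) p)) (lc≋0 p)))

  pivot : ∀ {a b} (d : Fin (suc a) → Fin (suc b) → Carrier) i₀ → ¬ (d i₀ zero ≡ 0#) → Fin a → Carrier
  pivot d i₀ d₀≢0 j = - (d (punchIn i₀ j) zero * d i₀ zero ⁻¹⟨ d₀≢0 ⟩)

  eliminate-head : ∀ {a b} (u : Fin (suc a) → V) (w : Fin (suc b) → V) (d : Fin (suc a) → Fin (suc b) → Carrier) →
                   (∀ i → u i ≋ lincomb (d i) w) → ∀ i₀ (d₀≢0 : ¬ (d i₀ zero ≡ 0#)) →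
                   ∀ j → Span (tail w) (eliminate u i₀ (pivot d i₀ d₀≢0) j)
  eliminate-head u w d u≋ i₀ d₀≢0 j =
      Span-tail e w u≋e (pivot-cancels (d i′ zero) (d i₀ zero) _ (*-inverseʳ (d i₀ zero) d₀≢0))
    where
      i′ = punchIn i₀ j
      sⱼ = pivot d i₀ d₀≢0 j
      e : Fin _ → Carrier
      e t = d i′ t + sⱼ * d i₀ t
      u≋e : (u i′ +V (sⱼ · u i₀)) ≋ lincomb e w
      u≋e p = trans (cong₂ _+_ (u≋ i′ p) (cong (sⱼ *_) (u≋ i₀ p)))
        (sym (trans (lincomb-+ (d i′) (λ t → sⱼ * d i₀ t) w p) (cong (lincomb (d i′) w p +_) (lincomb-· sⱼ (d i₀) w p))))

  -- Either some u i has an invertible coefficient on head w, and pivoting on it clears head w from the others,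
  -- or none has, and tail u already lies in Span (tail w).
  exchange : ∀ {a b} (w : Fin (suc b) → V) (u : Fin (suc a) → V) → LinearlyIndependent u → (∀ i → Span w (u i)) →
             Σ (Fin a → V) λ u′ → LinearlyIndependent u′ × (∀ j → Span (tail w) (u′ j)) × (∀ j → Span u (u′ j))
  exchange w u indep u⊆w with Fin.any? (λ i → ¬? (proj₁ (u⊆w i) zero ≟ 0#))
  ... | yes (i₀ , d₀≢0) =
        eliminate u i₀ s , eliminate-independent {v = u} i₀ s indep ,
        eliminate-head u w d (λ i → proj₂ (u⊆w i)) i₀ d₀≢0 ,
        λ j → Span-+ {v = u} (Span-generator u (punchIn i₀ j)) (Span-· {v = u} (s j) (Span-generator u i₀))
    where
      d = λ i → proj₁ (u⊆w i)
      s = pivot d i₀ d₀≢0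
  ... | no ∄d₀≢0 = tail u , LinearlyIndependent-tail {v = u} indep ,
        (λ j → Span-tail (proj₁ (u⊆w (suc j))) w (proj₂ (u⊆w (suc j)))
                 (decidable-stable (_ ≟ 0#) (λ d₀≢0 → ∄d₀≢0 (suc j , d₀≢0)))) ,
        Span-generator u ∘ suc

  indep⊆span⇒≤ : ∀ b {a} (w : Fin b → V) (u : Fin a → V) → LinearlyIndependent u → (∀ i → Span w (u i)) → a ≤ b
  indep⊆span⇒≤ b {zero} w u indep u⊆w = z≤n
  indep⊆span⇒≤ zero {suc a} w u indep u⊆w =
    ⊥-elim (0≢1 (sym (indep (λ _ → 1#) (proj₂ (Span-lincomb {w = w} {u = u} u⊆w (λ _ → 1#))) zero)))
  indep⊆span⇒≤ (suc b) {suc a} w u indep u⊆w =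
    let u′ , indep′ , u′⊆w , _ = exchange w u indep u⊆w in s≤s (indep⊆span⇒≤ b (tail w) u′ indep′ u′⊆w)

  spans-of-full-size : ∀ {k m} (b : Fin k → V) (u : Fin m → V) → LinearlyIndependent u → (∀ i → Span b (u i)) →
                       k ≤ m → ∀ {x} → Span b x → Span u x
  spans-of-full-size {k} b u indep u⊆b k≤m {x} x∈b with Span? {v = u} x
  ... | yes x∈u = x∈u
  ... | no x∉u = ⊥-elim (ℕₚ.1+n≰n (ℕₚ.≤-trans
          (indep⊆span⇒≤ k b (x ∷ u) (LinearlyIndependent-∷ indep x∉u) λ { zero → x∈b ; (suc i) → u⊆b i }) k≤m))

  ∃-outside-span : ∀ {k a} (b : Fin k → V) → LinearlyIndependent b → (u : Fin a → V) → a < k →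
                   ∃ λ i → ¬ Span u (b i)
  ∃-outside-span {k} {a} b indep u a<k with Fin.any? (λ i → ¬? (Span? {v = u} (b i)))
  ... | yes outside = outside
  ... | no ∄outside = ⊥-elim (ℕₚ.<⇒≱ a<k
          (indep⊆span⇒≤ a u b indep (λ i → decidable-stable (Span? (b i)) (λ b∉u → ∄outside (i , b∉u)))))

  record IsSubspace (S : V → Set) : Set where
    field
      ∈-cong : ∀ {x y} → x ≋ y → S x → S y
      ∈-0V : S 0V
      ∈-+ : ∀ {x y} → S x → S y → S (x +V y)
      ∈-· : ∀ a {x} → S x → S (a · x)
  open IsSubspace

  Span-isSubspace : ∀ {m} (v : Fin m → V) → IsSubspace (Span v)
  Span-isSubspace v = record { ∈-cong = Span-cong ; ∈-0V = Span-0V ; ∈-+ = Span-+ ; ∈-· = Span-· }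

  ∩-isSubspace : ∀ {S T} → IsSubspace S → IsSubspace T → IsSubspace (S ∩ T)
  ∩-isSubspace S T = record
    { ∈-cong = λ e (s , t) → ∈-cong S e s , ∈-cong T e t
    ; ∈-0V = ∈-0V S , ∈-0V T
    ; ∈-+ = λ (s , t) (s′ , t′) → ∈-+ S s s′ , ∈-+ T t t′
    ; ∈-· = λ a (s , t) → ∈-· S a s , ∈-· T a t
    }

  module _ {S : V → Set} (sub : IsSubspace S) where
    ∈-lincomb : ∀ {m} {u : Fin m → V} → (∀ i → S (u i)) → ∀ c → S (lincomb c u)
    ∈-lincomb {zero} u∈S c = ∈-0V sub
    ∈-lincomb {suc m} u∈S c = ∈-+ sub (∈-· sub (c zero) (u∈S zero)) (∈-lincomb (u∈S ∘ suc) (c ∘ suc))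

    Span⊆ : ∀ {m} {u : Fin m → V} → (∀ i → S (u i)) → ∀ {x} → Span u x → S x
    Span⊆ u∈S (c , x≋) = ∈-cong sub (≋-sym x≋) (∈-lincomb u∈S c)

    ∈-cancel : ∀ {c y l} → ¬ (c ≡ 0#) → S ((c · y) +V l) → S l → S y
    ∈-cancel {c} {y} {l} c≢0 cy+l∈S l∈S =
        ∈-cong sub y≋ (∈-· sub e (∈-+ sub cy+l∈S (∈-· sub (- 1#) l∈S)))
      where
        e = c ⁻¹⟨ c≢0 ⟩
        y≋ : (e · (((c · y) +V l) +V ((- 1#) · l))) ≋ y
        y≋ p = begin
          e * ((c * y p + l p) + - 1# * l p) ≡⟨ cong (λ t → e * ((c * y p + l p) + t)) (-1*x≈-x (l p)) ⟩
          e * ((c * y p + l p) + - l p)      ≡⟨ cong (e *_) (+-assoc (c * y p) (l p) (- l p)) ⟩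
          e * (c * y p + (l p + - l p))      ≡⟨ cong (λ t → e * (c * y p + t)) (-‿inverseʳ (l p)) ⟩
          e * (c * y p + 0#)                 ≡⟨ cong (e *_) (+-identityʳ _) ⟩
          e * (c * y p)                      ≡⟨ solve 3 (λ e c y → (e :* (c :* y)) := ((c :* e) :* y)) refl e c (y p) ⟩
          (c * e) * y p                      ≡⟨ cong (_* y p) (*-inverseʳ c c≢0) ⟩
          1# * y p                           ≡⟨ *-identityˡ (y p) ⟩
          y p                                ∎
          where open ≡-Reasoning

  module _ {P : V → Set} {m} (H : HasDim P m) where
    basis : Fin m → V
    basis = proj₁ H

    basis-independent : LinearlyIndependent basis
    basis-independent = proj₁ (proj₂ H)

    ∈⇒Span : ∀ {x} → P x → Span basis x
    ∈⇒Span = Equivalence.to (proj₂ (proj₂ H) _)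

    Span⇒∈ : ∀ {x} → Span basis x → P x
    Span⇒∈ = Equivalence.from (proj₂ (proj₂ H) _)

    basis-∈ : ∀ i → P (basis i)
    basis-∈ i = Span⇒∈ (Span-generator basis i)

    HasDim⇒isSubspace : IsSubspace P
    HasDim⇒isSubspace = record
      { ∈-cong = λ e → Span⇒∈ ∘ Span-cong e ∘ ∈⇒Span
      ; ∈-0V = Span⇒∈ Span-0V
      ; ∈-+ = λ x∈ y∈ → Span⇒∈ (Span-+ (∈⇒Span x∈) (∈⇒Span y∈))
      ; ∈-· = λ a → Span⇒∈ ∘ Span-· a ∘ ∈⇒Span
      }

    HasDim-cong : ∀ {Q : V → Set} → (∀ x → P x ⇔ Q x) → HasDim Q m
    HasDim-cong P⇔Q = basis , basis-independent ,
      λ x → mk⇔ (∈⇒Span ∘ Equivalence.from (P⇔Q x)) (Equivalence.to (P⇔Q x) ∘ Span⇒∈)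

  spanning⇒HasDim : ∀ {P m} (g : Fin m → V) → IsSubspace P → LinearlyIndependent g → (∀ i → P (g i)) →
                    (∀ {x} → P x → Span g x) → HasDim P m
  spanning⇒HasDim g sub indep g∈P P⊆g = g , indep , λ x → mk⇔ P⊆g (Span⊆ sub g∈P)

  HasDim-mono-≤ : ∀ {P Q : V → Set} {m k} → HasDim P m → HasDim Q k → (∀ {x} → P x → Q x) → m ≤ k
  HasDim-mono-≤ {k = k} HP HQ P⊆Q = indep⊆span⇒≤ k (basis HQ) (basis HP) (basis-independent HP)
    (λ i → ∈⇒Span HQ (P⊆Q (basis-∈ HP i)))

  code-isSubspace : ∀ {k} (X : Code k) → IsSubspace (pts X)
  code-isSubspace X = HasDim⇒isSubspace (dim X)

  pts? : ∀ {k} (X : Code k) x → Dec (pts X x)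
  pts? X x = Dec.map′ (Span⇒∈ (dim X)) (∈⇒Span (dim X)) (Span? x)

  -- The lower bound d(X, Y) ≤ d_c(X, Y)

  indep-into-adjacent : ∀ {k a S} (X Z : Code (suc k)) → Adjacent X Z → IsSubspace S →
                        (u : Fin (suc a) → V) → LinearlyIndependent u → (∀ i → (S ∩ pts X) (u i)) →
                        Σ (Fin a → V) λ u′ → LinearlyIndependent u′ × (∀ j → (S ∩ pts Z) (u′ j))
  indep-into-adjacent {k} X Z X~Z S-sub u indep u∈ =
      let u′ , indep′ , u′⊆h , u′⊆u = exchange (z ∷ h) u indep (λ i → X⊆z∷h (proj₂ (u∈ i)))
      in u′ , indep′ , λ j → Span⊆ S-sub (proj₁ ∘ u∈) (u′⊆u j) , proj₂ (Span⇒∈ X~Z (u′⊆h j))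
    where
      h = basis X~Z
      outside = ∃-outside-span (basis (dim X)) (basis-independent (dim X)) h (ℕₚ.n<1+n k)
      z = basis (dim X) (proj₁ outside)
      z∷h-independent : LinearlyIndependent (z ∷ h)
      z∷h-independent = LinearlyIndependent-∷ (basis-independent X~Z) (proj₂ outside)
      z∷h⊆X : ∀ i → Span (basis (dim X)) ((z ∷ h) i)
      z∷h⊆X zero = Span-generator (basis (dim X)) (proj₁ outside)
      z∷h⊆X (suc i) = ∈⇒Span (dim X) (proj₁ (basis-∈ X~Z i))
      X⊆z∷h : ∀ {x} → pts X x → Span (z ∷ h) x
      X⊆z∷h = spans-of-full-size (basis (dim X)) (z ∷ h) z∷h-independent z∷h⊆X ℕₚ.≤-refl ∘ ∈⇒Span (dim X)

  indep-along-path : ∀ {k S} l (X Y : Code (suc k)) → IsSubspace S → ∀ {a} (u : Fin a → V) → LinearlyIndependent u →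
                     (∀ i → (S ∩ pts X) (u i)) → Path X Y l →
                     Σ (Fin (a ∸ l) → V) λ u′ → LinearlyIndependent u′ × (∀ j → (S ∩ pts Y) (u′ j))
  indep-along-path zero X Y S-sub u indep u∈ (Level.lift X≈Y) =
    u , indep , λ j → proj₁ (u∈ j) , Equivalence.to (X≈Y _) (proj₂ (u∈ j))
  indep-along-path (suc l) X Y S-sub {zero} u indep u∈ _ = u , indep , λ ()
  indep-along-path (suc l) X Y S-sub {suc a} u indep u∈ (Z , Level.lift X~Z , Z⇝Y) =
    let u′ , indep′ , u′∈ = indep-into-adjacent X Z X~Z S-sub u indep u∈
    in indep-along-path l Z Y S-sub u′ indep′ u′∈ Z⇝Y

  m∸n≤o⇒m∸o≤n : ∀ m n o → m ∸ n ≤ o → m ∸ o ≤ n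
  m∸n≤o⇒m∸o≤n m n o le = ℕₚ.m≤n+o⇒m∸n≤o m o
    (ℕₚ.≤-trans (ℕₚ.m≤n+m∸n m n) (ℕₚ.≤-trans (ℕₚ.+-monoʳ-≤ n le) (ℕₚ.≤-reflexive (ℕₚ.+-comm n o))))

  distance-lower-bound : ∀ {k m} (X Y : Code (suc k)) → HasDim (pts X ∩ pts Y) m → ∀ l → Path X Y l → suc k ∸ m ≤ l
  distance-lower-bound {k} {m} X Y H l X⇝Y =
    let u , indep , u∈ = indep-along-path l X Y (code-isSubspace X) (basis (dim X)) (basis-independent (dim X))
                           (λ i → basis-∈ (dim X) i , basis-∈ (dim X) i) X⇝Y
    in m∸n≤o⇒m∸o≤n (suc k) l m (indep⊆span⇒≤ m (basis H) u indep (∈⇒Span H ∘ u∈))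

  -- Walks of length d(X, Y)

  NonDegenerate : ∀ {m} → (Fin m → V) → Set
  NonDegenerate b = ∀ i → ¬ (∀ x → Span b x → x i ≡ 0#)

  spanCode : ∀ {k} (b : Fin k → V) → LinearlyIndependent b → NonDegenerate b → Code k
  spanCode b indep nondeg = record
    { pts = Span b ; dim = b , indep , (λ x → mk⇔ (λ s → s) (λ s → s)) ; nondeg = nondeg }

  fullWeight⇒NonDegenerate : ∀ {m f} {b : Fin m → V} → FullWeight f → Span b f → NonDegenerate b
  fullWeight⇒NonDegenerate {f = f} fw f∈b i b⊆Cᵢ = fw i (b⊆Cᵢ f f∈b)

  -- Among the vectors c · y + l of Span (y ∷ h), only those with c = 0 lie in X, because y ∉ X.
  adjacent-span∷ : ∀ {k y} (X : Code (suc k)) (h : Fin k → V) → LinearlyIndependent h → (∀ i → pts X (h i)) →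
                   ¬ pts X y → HasDim (pts X ∩ Span (y ∷ h)) k
  adjacent-span∷ {y = y} X h indep h∈X y∉X =
      spanning⇒HasDim h (∩-isSubspace X-sub (Span-isSubspace (y ∷ h))) indep
        (λ i → h∈X i , Span-∷⁺ (Span-generator h i)) X∩⊆h
    where
      X-sub = code-isSubspace X
      X∩⊆h : ∀ {x} → (pts X ∩ Span (y ∷ h)) x → Span h x
      X∩⊆h (x∈X , c , x≋) with c zero ≟ 0#
      ... | yes c₀≡0 = Span-tail c (y ∷ h) x≋ c₀≡0
      ... | no c₀≢0 = ⊥-elim (y∉X (∈-cancel X-sub c₀≢0 (∈-cong X-sub x≋ x∈X) (Span⊆ X-sub h∈X (tail c , ≋-refl))))

  FullWeightIn : ∀ {k} → Code k → Code k → Set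
  FullWeightIn X Y = ∃ λ x → (pts X x ⊎ pts Y x) × FullWeight x

  record Closer {k} (X Y : Code k) (m : ℕ) : Set₁ where
    field
      next : Code k
      adjacent : Adjacent X next
      common : Fin m → V
      common-independent : LinearlyIndependent common
      common-∈ : ∀ i → (pts next ∩ pts Y) (common i)
      fullWeight : FullWeightIn next Y
  open Closer

  closer : ∀ {k m y f} (X Y : Code (suc k)) (h : Fin k → V) → LinearlyIndependent h → (∀ i → pts X (h i)) →
           ¬ pts X y → FullWeight f → Span (y ∷ h) f →
           (c : Fin m → V) → LinearlyIndependent c → (∀ i → Span (y ∷ h) (c i) × pts Y (c i)) → Closer X Y m
  closer {y = y} X Y h indep h∈X y∉X fw f∈ c c-indep c∈ = record
    { next = spanCode (y ∷ h) (LinearlyIndependent-∷ indep (y∉X ∘ Span⊆ (code-isSubspace X) h∈X))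
                        (fullWeight⇒NonDegenerate {b = y ∷ h} fw f∈)
    ; adjacent = adjacent-span∷ X h indep h∈X y∉X
    ; common = c
    ; common-independent = c-indep
    ; common-∈ = c∈
    ; fullWeight = _ , inj₁ f∈ , fw
    }

  Extension : ∀ {k a} → Code k → (Fin a → V) → ℕ → Set
  Extension X u j = Σ (Fin j → V) λ h → LinearlyIndependent h × (∀ i → pts X (h i)) × (∀ i → Span h (u i))

  extend : ∀ {k a} (X : Code k) j (u : Fin a → V) → LinearlyIndependent u → (∀ i → pts X (u i)) →
           a ≤ j → j ≤ k → Extension X u j
  extend {k} {a} X j u indep u∈X a≤j j≤k =
      subst (Extension X u) (ℕₚ.m∸n+n≡m a≤j) (extend-by (j ∸ a) (subst (_≤ k) (sym (ℕₚ.m∸n+n≡m a≤j)) j≤k))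
    where
      extend-by : ∀ d → d ℕ.+ a ≤ k → Extension X u (d ℕ.+ a)
      extend-by zero _ = u , indep , u∈X , Span-generator u
      extend-by (suc d) d+a<k =
        let h , h-indep , h∈X , u⊆h = extend-by d (ℕₚ.<⇒≤ d+a<k)
            i , bᵢ∉h = ∃-outside-span (basis (dim X)) (basis-independent (dim X)) h d+a<k
        in basis (dim X) i ∷ h , LinearlyIndependent-∷ h-indep bᵢ∉h ,
           (λ { zero → basis-∈ (dim X) i ; (suc j) → h∈X j }) , Span-∷⁺ ∘ u⊆h

  m+[2+t]≡1+k⇒m<k : ∀ m t k → m ℕ.+ suc (suc t) ≡ suc k → m < k
  m+[2+t]≡1+k⇒m<k m t k eq = ℕₚ.≤-pred (subst (suc (suc m) ≤_) eq
    (subst (_≤ m ℕ.+ suc (suc t)) (ℕₚ.+-comm m 2) (ℕₚ.+-monoʳ-≤ m (s≤s (s≤s z≤n)))))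

  -- The hyperplane H of X contains g, and also f when f ∈ X; y is f when f ∈ Y ∖ X, and otherwise a basis
  -- vector y₀ of Y outside X ∩ Y, which exists as dim (X ∩ Y) < dim Y.
  step-closer : ∀ {k m t} (X Y : Code (suc k)) (g : Fin m → V) → LinearlyIndependent g →
                (∀ i → (pts X ∩ pts Y) (g i)) → (∀ {x} → (pts X ∩ pts Y) x → Span g x) →
                m ℕ.+ suc (suc t) ≡ suc k → FullWeightIn X Y → Closer X Y (suc m)
  step-closer {k} {m} {t} X Y g indep g∈ X∩Y⊆g eq (f , f∈X∪Y , fw) = go (Span? f) f∈X∪Y
    where
      m<k = m+[2+t]≡1+k⇒m<k m t k eq
      g∈X = proj₁ ∘ g∈
      y₀-outside = ∃-outside-span (basis (dim Y)) (basis-independent (dim Y)) g (s≤s (ℕₚ.<⇒≤ m<k))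
      y₀ = basis (dim Y) (proj₁ y₀-outside)
      towards : ∀ {y} → pts Y y → ¬ Span g y → (h : Fin k → V) → LinearlyIndependent h → (∀ i → pts X (h i)) →
                (∀ i → Span h (g i)) → Span (y ∷ h) f → Closer X Y (suc m)
      towards y∈Y y∉g h h-indep h∈X g⊆h f∈ =
        closer X Y h h-indep h∈X (λ y∈X → y∉g (X∩Y⊆g (y∈X , y∈Y))) fw f∈ (_ ∷ g) (LinearlyIndependent-∷ indep y∉g)
          λ { zero → Span-head , y∈Y ; (suc i) → Span-∷⁺ (g⊆h i) , proj₂ (g∈ i) }
      go : Dec (Span g f) → pts X f ⊎ pts Y f → Closer X Y (suc m)
      go (yes f∈g) _ =
        let h , h-indep , h∈X , g⊆h = extend X k g indep g∈X (ℕₚ.<⇒≤ m<k) (ℕₚ.n≤1+n k)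
        in towards (basis-∈ (dim Y) _) (proj₂ y₀-outside) h h-indep h∈X g⊆h (Span-∷⁺ (Span-trans g⊆h f∈g))
      go (no f∉g) (inj₁ f∈X) =
        let h , h-indep , h∈X , f∷g⊆h = extend X k (f ∷ g) (LinearlyIndependent-∷ indep f∉g)
                                          (λ { zero → f∈X ; (suc i) → g∈X i }) m<k (ℕₚ.n≤1+n k)
        in towards (basis-∈ (dim Y) _) (proj₂ y₀-outside) h h-indep h∈X (f∷g⊆h ∘ suc) (Span-∷⁺ (f∷g⊆h zero))
      go (no f∉g) (inj₂ f∈Y) =
        let h , h-indep , h∈X , g⊆h = extend X k g indep g∈X (ℕₚ.<⇒≤ m<k) (ℕₚ.n≤1+n k)
        in towards f∈Y f∉g h h-indep h∈X g⊆h Span-head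

  step-to-allOnes : ∀ {k m} (X Y : Code (suc k)) (g : Fin m → V) → LinearlyIndependent g →
                    (∀ i → (pts X ∩ pts Y) (g i)) → m ≤ k → ¬ FullWeightIn X Y → Closer X Y m
  step-to-allOnes {k} X Y g indep g∈ m≤k ¬fw =
      let h , h-indep , h∈X , g⊆h = extend X k g indep (proj₁ ∘ g∈) m≤k (ℕₚ.n≤1+n k)
      in closer X Y h h-indep h∈X (λ 𝟙∈X → ¬fw (𝟙 , inj₁ 𝟙∈X , 𝟙-fullWeight)) 𝟙-fullWeight Span-head
                g indep (λ i → Span-∷⁺ (g⊆h i) , proj₂ (g∈ i))
    where
      𝟙 : V
      𝟙 _ = 1#
      𝟙-fullWeight : FullWeight 𝟙
      𝟙-fullWeight i 1≡0 = 0≢1 (sym 1≡0)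

  SameCode-refl : ∀ {k} {X : Code k} → SameCode X X
  SameCode-refl x = ⇔-id _

  sameCode-of-full : ∀ {k m} (X Y : Code k) (g : Fin m → V) → LinearlyIndependent g →
                     (∀ i → (pts X ∩ pts Y) (g i)) → k ≤ m → SameCode X Y
  sameCode-of-full X Y g indep g∈ k≤m x = mk⇔ (into X Y (proj₁ ∘ g∈) (proj₂ ∘ g∈)) (into Y X (proj₂ ∘ g∈) (proj₁ ∘ g∈))
    where
      into : ∀ A B → (∀ i → pts A (g i)) → (∀ i → pts B (g i)) → pts A x → pts B x
      into A B g∈A g∈B = Span⊆ (code-isSubspace B) g∈B
        ∘ spans-of-full-size (basis (dim A)) g indep (∈⇒Span (dim A) ∘ g∈A) k≤m ∘ ∈⇒Span (dim A)

  common-outside? : ∀ {k m} (X Y : Code k) (g : Fin m → V) → Dec (∃ λ v → (pts X ∩ pts Y) v × ¬ Span g v)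
  common-outside? X Y g = searchable-V _ (λ v → (pts? X v ×-dec pts? Y v) ×-dec ¬? (Span? v))
    λ e ((v∈X , v∈Y) , v∉g) →
      (∈-cong (code-isSubspace X) e v∈X , ∈-cong (code-isSubspace Y) e v∈Y) , v∉g ∘ Span-cong (≋-sym e)

  Path≤ : ∀ {k} → Code k → Code k → ℕ → Set₁
  Path≤ X Y t = Σ ℕ λ l → l ≤ t × Path X Y l

  path≤ : ∀ {k m} t (X Y : Code (suc k)) (g : Fin m → V) → LinearlyIndependent g →
          (∀ i → (pts X ∩ pts Y) (g i)) → m ℕ.+ t ≡ suc k → FullWeightIn X Y → Path≤ X Y t

  path≤-spanning : ∀ {k m} t (X Y : Code (suc k)) (g : Fin m → V) → LinearlyIndependent g →
                   (∀ i → (pts X ∩ pts Y) (g i)) → (∀ {x} → (pts X ∩ pts Y) x → Span g x) →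
                   m ℕ.+ suc t ≡ suc k → FullWeightIn X Y → Path≤ X Y (suc t)

  path≤ {m = m} zero X Y g indep g∈ eq fw =
    0 , z≤n , Level.lift (sameCode-of-full X Y g indep g∈ (ℕₚ.≤-reflexive (trans (sym eq) (ℕₚ.+-identityʳ m))))
  path≤ {m = m} (suc t) X Y g indep g∈ eq fw with common-outside? X Y g
  ... | yes (v , v∈ , v∉g) =
    let l , l≤t , X⇝Y = path≤ t X Y (v ∷ g) (LinearlyIndependent-∷ indep v∉g) (λ { zero → v∈ ; (suc i) → g∈ i })
                          (trans (sym (ℕₚ.+-suc m t)) eq) fw
    in l , ℕₚ.m≤n⇒m≤1+n l≤t , X⇝Y
  ... | no ∄v = path≤-spanning t X Y g indep g∈
    (λ {x} x∈ → decidable-stable (Span? x) (λ x∉g → ∄v (x , x∈ , x∉g))) eq fw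

  path≤-spanning {m = m} zero X Y g indep g∈ X∩Y⊆g eq fw =
    1 , ℕₚ.≤-refl , Y ,
    Level.lift (subst (HasDim (pts X ∩ pts Y)) (ℕₚ.suc-injective (trans (ℕₚ.+-comm 1 m) eq))
      (spanning⇒HasDim g (∩-isSubspace (code-isSubspace X) (code-isSubspace Y)) indep g∈ X∩Y⊆g)) ,
    Level.lift (SameCode-refl {X = Y})
  path≤-spanning {m = m} (suc t) X Y g indep g∈ X∩Y⊆g eq fw =
    let c = step-closer X Y g indep g∈ X∩Y⊆g eq fw
        l , l≤ , Z⇝Y = path≤ (suc t) (next c) Y (common c) (common-independent c) (common-∈ c)
                         (trans (sym (ℕₚ.+-suc m (suc t))) eq) (fullWeight c)
    in suc l , s≤s l≤ , next c , Level.lift (adjacent c) , Z⇝Y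

  -- Deciding whether a walk of given length exists

  ∩-congˡ : ∀ {P P′ Q : V → Set} → (∀ x → P x ⇔ P′ x) → ∀ x → (P ∩ Q) x ⇔ (P′ ∩ Q) x
  ∩-congˡ P⇔P′ x = mk⇔ (λ (p , q) → Equivalence.to (P⇔P′ x) p , q) (λ (p , q) → Equivalence.from (P⇔P′ x) p , q)

  Path-congˡ : ∀ {k} l {X X′ Y : Code k} → SameCode X X′ → Path X Y l → Path X′ Y l
  Path-congˡ zero X≈X′ (Level.lift X≈Y) = Level.lift λ x → X≈Y x ⇔-∘ ⇔-sym (X≈X′ x)
  Path-congˡ (suc l) X≈X′ (Z , Level.lift X~Z , Z⇝Y) = Z , Level.lift (HasDim-cong X~Z (∩-congˡ X≈X′)) , Z⇝Y

  HasDim? : ∀ {P : V → Set} → (∀ x → Dec (P x)) → (∀ {x y} → x ≋ y → P x → P y) → ∀ j → Dec (HasDim P j)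
  HasDim? {P} P? P-cong j = searchable-families j (λ b → LinearlyIndependent b × (∀ x → P x ⇔ Span b x))
      (λ b → LinearlyIndependent? b ×-dec ∀V? (λ x → P x ⇔ Span b x) (λ x → P? x ⇔? Span? x) (⇔-cong b))
      λ e (indep , P⇔b) → LinearlyIndependent-cong e indep ,
        λ x → mk⇔ (Span-generators-cong e ∘ Equivalence.to (P⇔b x))
                  (Equivalence.from (P⇔b x) ∘ Span-generators-cong (≋-sym ∘ e))
    where
      ⇔-cong : ∀ b {x y} → x ≋ y → (P x ⇔ Span b x) → (P y ⇔ Span b y)
      ⇔-cong b e P⇔b = mk⇔ (Span-cong e ∘ Equivalence.to P⇔b ∘ P-cong (≋-sym e))
                           (P-cong e ∘ Equivalence.from P⇔b ∘ Span-cong (≋-sym e))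

  NonDegenerate? : ∀ {m} (b : Fin m → V) → Dec (NonDegenerate b)
  NonDegenerate? b = Fin.all? λ i → ¬? (∀V? (λ x → Span b x → x i ≡ 0#) (λ x → Span? x →-dec (x i ≟ 0#))
                                          (λ e b⊆Cᵢ → trans (sym (e i)) ∘ b⊆Cᵢ ∘ Span-cong (≋-sym e)))

  SameCode? : ∀ {k} (X Y : Code k) → Dec (SameCode X Y)
  SameCode? X Y = ∀V? (λ x → pts X x ⇔ pts Y x) (λ x → pts? X x ⇔? pts? Y x)
    λ e X⇔Y → mk⇔ (∈-cong (code-isSubspace Y) e ∘ Equivalence.to X⇔Y ∘ ∈-cong (code-isSubspace X) (≋-sym e))
                  (∈-cong (code-isSubspace X) e ∘ Equivalence.from X⇔Y ∘ ∈-cong (code-isSubspace Y) (≋-sym e))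

  Adjacent? : ∀ {k} (X Z : Code k) → Dec (Adjacent X Z)
  Adjacent? {k} X Z = HasDim? (λ x → pts? X x ×-dec pts? Z x)
    (λ e (x∈X , x∈Z) → ∈-cong (code-isSubspace X) e x∈X , ∈-cong (code-isSubspace Z) e x∈Z) (k ∸ 1)

  -- A walk's first step is searched for through a basis of the neighbour, as codes themselves cannot be enumerated.
  Path? : ∀ {k} l (X Y : Code k) → Dec (Path X Y l)
  Path? zero X Y = Dec.map′ Level.lift Level.lower (SameCode? X Y)
  Path? {k} (suc l) X Y = Dec.map′ toPath fromPath (searchable-families k FirstStep FirstStep? FirstStep-cong)
    where
      FirstStep : (Fin k → V) → Set₁
      FirstStep b = Σ (LinearlyIndependent b) λ indep → Σ (NonDegenerate b) λ nondeg →
                    Adjacent X (spanCode b indep nondeg) × Path (spanCode b indep nondeg) Y l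
      FirstStep? : ∀ b → Dec (FirstStep b)
      FirstStep? b with LinearlyIndependent? b | NonDegenerate? b
      ... | no ¬indep | _ = no (¬indep ∘ proj₁)
      ... | yes _ | no ¬nondeg = no (¬nondeg ∘ proj₁ ∘ proj₂)
      ... | yes indep | yes nondeg =
        Dec.map′ (λ (X~Z , Z⇝Y) → indep , nondeg , X~Z , Z⇝Y)
                 (λ (_ , _ , X~Z , Z⇝Y) → X~Z , Path-congˡ l (λ _ → ⇔-id _) Z⇝Y)
                 (Adjacent? X (spanCode b indep nondeg) ×-dec Path? l (spanCode b indep nondeg) Y)
      FirstStep-cong : ∀ {b b′} → Pointwise _≋_ b b′ → FirstStep b → FirstStep b′
      FirstStep-cong e (indep , nondeg , X~Z , Z⇝Y) =
        LinearlyIndependent-cong e indep ,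
        (λ i b⊆Cᵢ → nondeg i (λ x → b⊆Cᵢ x ∘ Span-generators-cong e)) ,
        HasDim-cong X~Z (λ x → mk⇔ (λ (x∈X , x∈b) → x∈X , Span-generators-cong e x∈b)
                                   (λ (x∈X , x∈b′) → x∈X , Span-generators-cong (≋-sym ∘ e) x∈b′)) ,
        Path-congˡ l (λ x → mk⇔ (Span-generators-cong e) (Span-generators-cong (≋-sym ∘ e))) Z⇝Y
      toPath : ∃ FirstStep → Path X Y (suc l)
      toPath (b , indep , nondeg , X~Z , Z⇝Y) = spanCode b indep nondeg , Level.lift X~Z , Z⇝Y
      fromPath : Path X Y (suc l) → ∃ FirstStep
      fromPath (Z , Level.lift X~Z , Z⇝Y) =
        basis (dim Z) , basis-independent (dim Z) ,
        (λ i b⊆Cᵢ → nondeg Z i (λ x → b⊆Cᵢ x ∘ ∈⇒Span (dim Z))) ,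
        HasDim-cong X~Z (λ x → mk⇔ (λ (x∈X , x∈Z) → x∈X , ∈⇒Span (dim Z) x∈Z) (λ (x∈X , x∈b) → x∈X , Span⇒∈ (dim Z) x∈b)) ,
        Path-congˡ l (λ x → proj₂ (proj₂ (dim Z)) x) Z⇝Y

  DistC-of-bounds : ∀ {k d} {X Y : Code k} → (∀ l → Path X Y l → d ≤ l) → Path≤ X Y d → DistC X Y d
  DistC-of-bounds {X = X} {Y} d≤ (l , l≤d , X⇝Y) = subst (Path X Y) (ℕₚ.≤-antisym l≤d (d≤ l X⇝Y)) X⇝Y , d≤

  DistC-within-one : ∀ {k d} {X Y : Code k} → (∀ l → Path X Y l → d ≤ l) → Path≤ X Y (suc d) →
                     Dec (Path X Y d) → Σ ℕ λ l → DistC X Y l × d ≤ l × l ≤ d ℕ.+ 1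
  DistC-within-one {d = d} d≤ _ (yes X⇝Y) = d , (X⇝Y , d≤) , ℕₚ.≤-refl , ℕₚ.m≤m+n d 1
  DistC-within-one {d = d} {X} {Y} d≤ (l , l≤1+d , X⇝Y) (no ¬X⇝Y) =
      l , (X⇝Y , minimal) , d≤ l X⇝Y , subst (l ≤_) (ℕₚ.+-comm 1 d) l≤1+d
    where
      minimal : ∀ l′ → Path X Y l′ → l ≤ l′
      minimal l′ X⇝′Y with ℕₚ.m≤n⇒m<n∨m≡n (d≤ l′ X⇝′Y)
      ... | inj₁ d<l′ = ℕₚ.≤-trans l≤1+d d<l′
      ... | inj₂ d≡l′ = ⊥-elim (¬X⇝Y (subst (Path X Y) (sym d≡l′) X⇝′Y))

  distC-with-fullWeight : ∀ {k m} (X Y : Code (suc k)) → HasDim (pts X ∩ pts Y) m → FullWeightIn X Y →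
                          DistC X Y (suc k ∸ m)
  distC-with-fullWeight {k} {m} X Y H fw =
    DistC-of-bounds (distance-lower-bound X Y H)
      (path≤ (suc k ∸ m) X Y (basis H) (basis-independent H) (basis-∈ H)
        (ℕₚ.m+[n∸m]≡n (HasDim-mono-≤ H (dim X) proj₁)) fw)

  distC-without-fullWeight : ∀ {k m} (X Y : Code (suc k)) → HasDim (pts X ∩ pts Y) m → ¬ FullWeightIn X Y →
                             Σ ℕ λ l → DistC X Y l × (suc k ∸ m ≤ l) × (l ≤ (suc k ∸ m) ℕ.+ 1)
  distC-without-fullWeight {k} {m} X Y H ¬fw = DistC-within-one (distance-lower-bound X Y H) walk (Path? _ X Y)
    where
      m≤1+k = HasDim-mono-≤ H (dim X) proj₁
      walk : Path≤ X Y (suc (suc k ∸ m))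
      walk with ℕₚ.m≤n⇒m<n∨m≡n m≤1+k
      ... | inj₂ m≡1+k =
        0 , z≤n , Level.lift (sameCode-of-full X Y (basis H) (basis-independent H) (basis-∈ H) (ℕₚ.≤-reflexive (sym m≡1+k)))
      ... | inj₁ m<1+k =
        let c = step-to-allOnes X Y (basis H) (basis-independent H) (basis-∈ H) (ℕₚ.≤-pred m<1+k) ¬fw
            l , l≤ , Z⇝Y = path≤ (suc k ∸ m) (next c) Y (common c) (common-independent c) (common-∈ c)
                             (ℕₚ.m+[n∸m]≡n m≤1+k) (fullWeight c)
        in suc l , s≤s l≤ , next c , Level.lift (adjacent c) , Z⇝Y

corollary1 : (q : ℕ) → IsPrimePower q → (F : FiniteField q) → (n k : ℕ) → 1 < k → k < n ∸ 1 →
    let open LinearAlgebra F n in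
    (X Y : Code k) → (m : ℕ) → HasDim (pts X ∩ pts Y) m →
    ((∃ λ x → (pts X x ⊎ pts Y x) × FullWeight x) → DistC X Y (k ∸ m))
    × (¬ (∃ λ x → (pts X x ⊎ pts Y x) × FullWeight x) →
    Σ ℕ λ l → DistC X Y l × (k ∸ m ≤ l) × (l ≤ (k ∸ m) ℕ.+ 1))
corollary1 q _ F n zero () _
corollary1 q _ F n (suc k) _ _ X Y m H = distC-with-fullWeight X Y H , distC-without-fullWeight X Y H
  where open CodeGraph F n
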